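{- Let $\mathcal{A}$, $\delta$ and the Catalan family $\mathcal{C}$ be as defined in the context. Then the members of $\mathcal{C}$ are precisely the self-describing sequences, i.e. the fixed points of $\delta$ in $\mathcal{A}$. Moreover, for every $a\in\mathcal{A}$, repeated applications of $\delta$ to $a$ eventually produce a member of $\mathcal{C}$ (a fixed point of $\delta$), and for $a$ of length $n+1$ the number of applications needed is $O(n^2)$.
   Context: $\mathcal{A}$ is the set of finite integer sequences $a=(a_0,\dots,a_n)$ ($n\ge0$) with $0\le a_i\le i$ for all $i$; $\mathcal{A}_n$ is the set of those of length $n+1$. Define $\delta:\mathcal{A}\to\mathcal{A}$ by $(\delta a)_i=\#\{j : j<i,\ a_j<a_i\}$ (same length as $a$). A sequence $a$ is self-describing if $\delta a=a$. The Catalan family $\mathcal{C}=\bigcup_n\mathcal{C}_n$, $\mathcal{C}_n\subseteq\mathcal{A}_n$, is defined recursively: $\mathcal{C}_0=\{(0)\}$; for $a=(a_0,\dots,a_n)\in\mathcal{C}_n$ let $S(a)=\{x : (a_0,\dots,a_{n-1},x)\in\mathcal{C}_n\}$ (for $n=0$, $S((0))=\{0\}$); then $\mathcal{C}_{n+1}$ consists of all sequences $(a_0,\dots,a_n,y)$ with $a\in\mathcal{C}_n$ and $y\in\{s\in S(a): s\le a_n\}\cup\{n+1\}$. (Equivalently, in tree language: the root is labelled $0$ and has children $0,1$; among siblings ordered by increasing label, the $j$-th oldest, at generation $n-1$, has $j+1$ children labelled by the labels of the $j$ oldest siblings in order, followed by $n$.) -}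

module Defs where

open import Data.Nat using (ℕ; zero; suc; _≤_; _<_; _<ᵇ_)
open import Data.Fin using (Fin; toℕ; _<?_)
open import Data.Vec using (Vec; []; _∷_; _∷ʳ_; lookup; tabulate)
open import Data.Product using (_×_)
open import Data.Sum using (_⊎_)
open import Data.List using (List; length; filter; allFin)
open import Data.Bool using (Bool; if_then_else_)
open import Relation.Binary.PropositionalEquality using (_≡_)
open import Data.Nat using () renaming (_<?_ to _<ℕ?_)

InA : ∀ {n} → Vec ℕ (suc n) → Set
InA {n} a = ∀ (i : Fin (suc n)) → lookup a i ≤ toℕ i

countBelow : ∀ {n} → Vec ℕ (suc n) → Fin (suc n) → ℕ
countBelow {n} a i =
  length (filter (λ j → j <? i) (filter (λ j → lookup a j <ℕ? lookup a i) (allFin (suc n))))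

δ : ∀ {n} → Vec ℕ (suc n) → Vec ℕ (suc n)
δ a = tabulate (countBelow a)

iter : ∀ {A : Set} → (A → A) → ℕ → A → A
iter f zero x = x
iter f (suc k) x = f (iter f k x)

-- C_0 = {(0)}; C_1 = {(0,y) : y ∈ {s ∈ S((0)) : s ≤ 0} ∪ {1}} with S((0)) = {0};
-- for n = m+1 ≥ 1: (p,x) ∈ C_n, y ∈ {s : (p,s) ∈ C_n, s ≤ x} ∪ {n+1}  ⇒ (p,x,y) ∈ C_{n+1}.
data Cat : (n : ℕ) → Vec ℕ (suc n) → Set where
  cat0 : Cat 0 (0 ∷ [])
  cat1 : ∀ (y : ℕ) → ((y ≡ 0 × y ≤ 0) ⊎ y ≡ 1) → Cat 1 (0 ∷ y ∷ [])
  catS : ∀ {m} (p : Vec ℕ (suc m)) (x y : ℕ) →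
         Cat (suc m) (p ∷ʳ x) →
         ((Cat (suc m) (p ∷ʳ y) × y ≤ x) ⊎ y ≡ suc (suc m)) →
         Cat (suc (suc m)) ((p ∷ʳ x) ∷ʳ y)

{-# OPTIONS --safe #-}
-- Appending an entry only appends to δ: δ (p ∷ʳ x) = δ p ∷ʳ rank p x, where rank p x counts
-- the entries of p below x. So a sequence is self-describing iff its prefix is and its last
-- entry is a fixed point of rank p. For p ∈ 𝒜 of length n + 1, rank p is monotone, bounded by
-- n + 1, and y ≤ rank p y whenever y ≤ n + 1; hence after a self-describing (p , x) the possible
-- last entries are the fixed points of rank p that are ≤ x, together with n + 2: the
-- recursion defining 𝒞. Iterating δ on a sequence of length n + 1, its prefix stabilises first
-- (inductively); from then on the last entry follows the monotone map rank of the fixed prefix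
-- on {0, …, n} and becomes fixed within n more steps. Summing over the entries gives n².
module Submission where

open import Defs
open import Data.Bool using (true; false)
open import Data.Fin as Fin using (Fin; zero; suc; inject₁; fromℕ)
open import Data.Fin.Properties using (toℕ-inject₁; toℕ-fromℕ; toℕ<n; ≤fromℕ)
open import Data.List as List using (List; []; _∷_; [_]; _++_; length; filter; allFin)
open import Data.List.Properties
  using (length-filter; length-tabulate; length-++; filter-++; filter-≐; filter-accept; filter-reject)
open import Data.List.Relation.Binary.Sublist.Propositional using (⊆-refl)
open import Data.List.Relation.Binary.Sublist.Propositional.Properties using (filter⁺; length-mono-≤)
open import Data.Nat using (ℕ; zero; suc; _+_; _*_; _≤_; _<_; _≮_; z≤n; s≤s; s≤s⁻¹; _<?_; _≟_)
open import Data.Nat.Properties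
open import Data.Product as Product using (_×_; _,_; proj₁; proj₂; ∃-syntax)
open import Data.Sum as Sum using (_⊎_; inj₁; inj₂)
open import Data.Vec using (Vec; []; _∷_; _∷ʳ_; lookup; tabulate; initLast)
open import Data.Vec.Properties using (∷ʳ-injective; tabulate-cong)
open import Function using (_∘_)
open import Function.Bundles using (_⇔_; mk⇔; module Equivalence)
open import Level using (Level; 0ℓ)
open import Relation.Binary.PropositionalEquality
  using (_≡_; refl; sym; trans; cong; cong₂; subst; subst₂; module ≡-Reasoning)
open import Relation.Nullary using (¬_; does; yes; no; _×-dec_)
open import Relation.Unary using (Pred; Decidable; _⊆_; _≐_)
open import Relation.Unary.Properties using (_∩?_)

open Equivalence using (to; from)

private variable
  a ℓ ℓ′ : Level
  A : Set a
  d d′ n : ℕ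
  x y y′ : ℕ

count : {P : Pred (Fin n) ℓ} → Decidable P → ℕ
count P? = length (filter P? (allFin _))

filter-filter : {P : Pred A ℓ} {Q : Pred A ℓ′} (P? : Decidable P) (Q? : Decidable Q) (xs : List A) →
                filter P? (filter Q? xs) ≡ filter (Q? ∩? P?) xs
filter-filter P? Q? []       = refl
filter-filter P? Q? (x ∷ xs) with does (Q? x)
... | false = filter-filter P? Q? xs
... | true with does (P? x)
...   | true  = cong (x ∷_) (filter-filter P? Q? xs)
...   | false = filter-filter P? Q? xs

length-filter-tabulate : {P : Pred A ℓ} (P? : Decidable P) (f : Fin n → A) →
                         length (filter P? (List.tabulate f)) ≡ count (λ i → P? (f i))
length-filter-tabulate {n = zero}  P? f = refl
length-filter-tabulate {n = suc n} P? f
  with does (P? (f zero))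
     | trans (length-filter-tabulate P? (f ∘ suc)) (sym (length-filter-tabulate (λ i → P? (f i)) suc))
... | true  | tails = cong suc tails
... | false | tails = tails

module _ {P : Pred (Fin (suc n)) ℓ} (P? : Decidable P) where

  count-∷ʳ : count P? ≡ count (λ i → P? (inject₁ i)) + length (filter P? [ fromℕ n ])
  count-∷ʳ = begin
    length (filter P? (allFin (suc n)))
      ≡⟨ cong (length ∘ filter P?) (tabulate-∷ʳ (λ i → i)) ⟩
    length (filter P? (List.tabulate inject₁ ++ [ fromℕ n ]))
      ≡⟨ cong length (filter-++ P? (List.tabulate inject₁) [ fromℕ n ]) ⟩
    length (filter P? (List.tabulate inject₁) ++ filter P? [ fromℕ n ])
      ≡⟨ length-++ (filter P? (List.tabulate inject₁)) ⟩
    length (filter P? (List.tabulate inject₁)) + length (filter P? [ fromℕ n ])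
      ≡⟨ cong (_+ length (filter P? [ fromℕ n ])) (length-filter-tabulate P? inject₁) ⟩
    count (λ i → P? (inject₁ i)) + length (filter P? [ fromℕ n ]) ∎
    where
    open ≡-Reasoning
    tabulate-∷ʳ : ∀ {m} (f : Fin (suc m) → A) →
                  List.tabulate f ≡ List.tabulate (f ∘ inject₁) ++ [ f (fromℕ m) ]
    tabulate-∷ʳ {m = zero}  f = refl
    tabulate-∷ʳ {m = suc m} f = cong (f zero ∷_) (tabulate-∷ʳ (f ∘ suc))

  count-∷ʳ-accept : P (fromℕ n) → count P? ≡ suc (count (λ i → P? (inject₁ i)))
  count-∷ʳ-accept p = trans count-∷ʳ
    (trans (cong (λ xs → count (λ i → P? (inject₁ i)) + length xs) (filter-accept P? p)) (+-comm _ 1))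

  count-∷ʳ-reject : ¬ P (fromℕ n) → count P? ≡ count (λ i → P? (inject₁ i))
  count-∷ʳ-reject ¬p = trans count-∷ʳ
    (trans (cong (λ xs → count (λ i → P? (inject₁ i)) + length xs) (filter-reject P? ¬p)) (+-identityʳ _))

count≤n : {P : Pred (Fin n) ℓ} (P? : Decidable P) → count P? ≤ n
count≤n {n = n} P? = ≤-trans (length-filter P? (allFin n)) (≤-reflexive (length-tabulate (λ i → i)))

count-mono : {P : Pred (Fin n) ℓ} {Q : Pred (Fin n) ℓ′} (P? : Decidable P) (Q? : Decidable Q) →
             P ⊆ Q → count P? ≤ count Q?
count-mono P? Q? P⊆Q = length-mono-≤ (filter⁺ P? Q? (λ { refl → P⊆Q }) (⊆-refl {x = allFin _}))

count-cong : {P : Pred (Fin n) ℓ} {Q : Pred (Fin n) ℓ′} (P? : Decidable P) (Q? : Decidable Q) →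
             P ≐ Q → count P? ≡ count Q?
count-cong P? Q? P≐Q = cong length (filter-≐ P? Q? P≐Q (allFin _))

lookup-∷ʳ-inject₁ : (p : Vec A n) (x : A) (i : Fin n) → lookup (p ∷ʳ x) (inject₁ i) ≡ lookup p i
lookup-∷ʳ-inject₁ (_ ∷ p) x zero    = refl
lookup-∷ʳ-inject₁ (_ ∷ p) x (suc i) = lookup-∷ʳ-inject₁ p x i

lookup-∷ʳ-fromℕ : (p : Vec A n) (x : A) → lookup (p ∷ʳ x) (fromℕ n) ≡ x
lookup-∷ʳ-fromℕ []      x = refl
lookup-∷ʳ-fromℕ (_ ∷ p) x = lookup-∷ʳ-fromℕ p x

tabulate-∷ʳ : (f : Fin (suc n) → A) → tabulate f ≡ tabulate (f ∘ inject₁) ∷ʳ f (fromℕ n)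
tabulate-∷ʳ {n = zero}  f = refl
tabulate-∷ʳ {n = suc n} f = cong (f zero ∷_) (tabulate-∷ʳ (f ∘ suc))

fromℕ-or-inject₁ : (i : Fin (suc n)) → i ≡ fromℕ n ⊎ ∃[ j ] i ≡ inject₁ j
fromℕ-or-inject₁ {n = zero}  zero    = inj₁ refl
fromℕ-or-inject₁ {n = suc n} zero    = inj₂ (zero , refl)
fromℕ-or-inject₁ {n = suc n} (suc i) = Sum.map (cong suc) (Product.map suc (cong suc)) (fromℕ-or-inject₁ i)

InA-∷ʳ : (p : Vec ℕ (suc n)) (x : ℕ) → InA (p ∷ʳ x) ⇔ (InA p × x ≤ suc n)
InA-∷ʳ {n} p x = mk⇔ split join
  where
  split : InA (p ∷ʳ x) → InA p × x ≤ suc n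
  split h = (λ i → subst₂ _≤_ (lookup-∷ʳ-inject₁ p x i) (toℕ-inject₁ i) (h (inject₁ i)))
          , subst₂ _≤_ (lookup-∷ʳ-fromℕ p x) (toℕ-fromℕ (suc n)) (h (fromℕ (suc n)))
  join : InA p × x ≤ suc n → InA (p ∷ʳ x)
  join (hp , x≤) i with fromℕ-or-inject₁ i
  ... | inj₁ refl       = subst₂ _≤_ (sym (lookup-∷ʳ-fromℕ p x)) (sym (toℕ-fromℕ (suc n))) x≤
  ... | inj₂ (j , refl) = subst₂ _≤_ (sym (lookup-∷ʳ-inject₁ p x j)) (sym (toℕ-inject₁ j)) (hp j)

rank : Vec ℕ n → ℕ → ℕ
rank p y = count (λ j → lookup p j <? y)

rank≤n : (p : Vec ℕ n) (y : ℕ) → rank p y ≤ n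
rank≤n p y = count≤n (λ j → lookup p j <? y)

rank-mono : (p : Vec ℕ n) → y ≤ y′ → rank p y ≤ rank p y′
rank-mono {y = y} {y′} p y≤y′ =
  count-mono (λ j → lookup p j <? y) (λ j → lookup p j <? y′) (λ v<y → <-≤-trans v<y y≤y′)

module _ (p : Vec ℕ n) (x : ℕ) where

  private
    rank-init : (y : ℕ) → count (λ j → lookup (p ∷ʳ x) (inject₁ j) <? y) ≡ rank p y
    rank-init y = count-cong (λ j → lookup (p ∷ʳ x) (inject₁ j) <? y) (λ j → lookup p j <? y)
      ( (λ {j} → subst (_< y) (lookup-∷ʳ-inject₁ p x j))
      , (λ {j} → subst (_< y) (sym (lookup-∷ʳ-inject₁ p x j))))

  rank-∷ʳ-< : x < y → rank (p ∷ʳ x) y ≡ suc (rank p y)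
  rank-∷ʳ-< {y} x<y = trans
    (count-∷ʳ-accept (λ j → lookup (p ∷ʳ x) j <? y) (subst (_< y) (sym (lookup-∷ʳ-fromℕ p x)) x<y))
    (cong suc (rank-init y))

  rank-∷ʳ-≮ : x ≮ y → rank (p ∷ʳ x) y ≡ rank p y
  rank-∷ʳ-≮ {y} x≮y = trans
    (count-∷ʳ-reject (λ j → lookup (p ∷ʳ x) j <? y) (x≮y ∘ subst (_< y) (lookup-∷ʳ-fromℕ p x)))
    (rank-init y)

  rank≤rank-∷ʳ : (y : ℕ) → rank p y ≤ rank (p ∷ʳ x) y
  rank≤rank-∷ʳ y with x <? y
  ... | yes x<y = ≤-trans (n≤1+n _) (≤-reflexive (sym (rank-∷ʳ-< x<y)))
  ... | no x≮y  = ≤-reflexive (sym (rank-∷ʳ-≮ x≮y))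

≤-rank : (p : Vec ℕ (suc n)) → InA p → y ≤ suc n → y ≤ rank p y
≤-rank {zero} (v ∷ []) h y≤1 with h zero | y≤1
... | z≤n | z≤n     = z≤n
... | z≤n | s≤s z≤n = s≤s z≤n
≤-rank {suc n} {y} p h y≤ with initLast p
... | q , x , refl with to (InA-∷ʳ q x) h | m≤n⇒m<n∨m≡n y≤
... | hq , x≤ | inj₁ (s≤s y≤′) = ≤-trans (≤-rank q hq y≤′) (rank≤rank-∷ʳ q x y)
... | hq , x≤ | inj₂ refl      = begin
  suc (suc n)                 ≤⟨ s≤s (≤-rank q hq ≤-refl) ⟩
  suc (rank q (suc n))        ≤⟨ s≤s (rank-mono q (n≤1+n _)) ⟩
  suc (rank q (suc (suc n)))  ≡⟨ rank-∷ʳ-< q x (s≤s x≤) ⟨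
  rank (q ∷ʳ x) (suc (suc n)) ∎
  where open ≤-Reasoning

Below : Vec ℕ (suc n) → Fin (suc n) → Pred (Fin (suc n)) 0ℓ
Below a i j = lookup a j < lookup a i × j Fin.< i

below? : (a : Vec ℕ (suc n)) (i : Fin (suc n)) → Decidable (Below a i)
below? a i j = (lookup a j <? lookup a i) ×-dec (j Fin.<? i)

countBelow≡count : (a : Vec ℕ (suc n)) (i : Fin (suc n)) → countBelow a i ≡ count (below? a i)
countBelow≡count a i =
  cong length (filter-filter (λ j → j Fin.<? i) (λ j → lookup a j <? lookup a i) (allFin _))

countBelow-∷ʳ-inject₁ : (p : Vec ℕ (suc n)) (x : ℕ) (i : Fin (suc n)) →
                        countBelow (p ∷ʳ x) (inject₁ i) ≡ countBelow p i
countBelow-∷ʳ-inject₁ {n} p x i = begin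
  countBelow (p ∷ʳ x) (inject₁ i)
    ≡⟨ countBelow≡count (p ∷ʳ x) (inject₁ i) ⟩
  count (below? (p ∷ʳ x) (inject₁ i))
    ≡⟨ count-∷ʳ-reject (below? (p ∷ʳ x) (inject₁ i)) last≮i ⟩
  count (λ j → below? (p ∷ʳ x) (inject₁ i) (inject₁ j))
    ≡⟨ count-cong (λ j → below? (p ∷ʳ x) (inject₁ i) (inject₁ j)) (below? p i) (restrict , extend) ⟩
  count (below? p i)
    ≡⟨ countBelow≡count p i ⟨
  countBelow p i ∎
  where
  open ≡-Reasoning
  last≮i : ¬ Below (p ∷ʳ x) (inject₁ i) (fromℕ (suc n))
  last≮i = ≤⇒≯ (≤fromℕ (inject₁ i)) ∘ proj₂
  restrict : ∀ {j} → Below (p ∷ʳ x) (inject₁ i) (inject₁ j) → Below p i j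
  restrict {j} = Product.map (subst₂ _<_ (lookup-∷ʳ-inject₁ p x j) (lookup-∷ʳ-inject₁ p x i))
                             (subst₂ _<_ (toℕ-inject₁ j) (toℕ-inject₁ i))
  extend : ∀ {j} → Below p i j → Below (p ∷ʳ x) (inject₁ i) (inject₁ j)
  extend {j} = Product.map (subst₂ _<_ (sym (lookup-∷ʳ-inject₁ p x j)) (sym (lookup-∷ʳ-inject₁ p x i)))
                           (subst₂ _<_ (sym (toℕ-inject₁ j)) (sym (toℕ-inject₁ i)))

countBelow-∷ʳ-fromℕ : (p : Vec ℕ n) (x : ℕ) → countBelow (p ∷ʳ x) (fromℕ n) ≡ rank p x
countBelow-∷ʳ-fromℕ {n} p x = begin
  countBelow (p ∷ʳ x) (fromℕ n)
    ≡⟨ countBelow≡count (p ∷ʳ x) (fromℕ n) ⟩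
  count (below? (p ∷ʳ x) (fromℕ n))
    ≡⟨ count-∷ʳ-reject (below? (p ∷ʳ x) (fromℕ n)) (<-irrefl refl ∘ proj₂) ⟩
  count (λ j → below? (p ∷ʳ x) (fromℕ n) (inject₁ j))
    ≡⟨ count-cong (λ j → below? (p ∷ʳ x) (fromℕ n) (inject₁ j)) (λ j → lookup p j <? x) (restrict , extend) ⟩
  rank p x ∎
  where
  open ≡-Reasoning
  restrict : ∀ {j} → Below (p ∷ʳ x) (fromℕ n) (inject₁ j) → lookup p j < x
  restrict {j} = subst₂ _<_ (lookup-∷ʳ-inject₁ p x j) (lookup-∷ʳ-fromℕ p x) ∘ proj₁
  extend : ∀ {j} → lookup p j < x → Below (p ∷ʳ x) (fromℕ n) (inject₁ j)
  extend {j} v<x = subst₂ _<_ (sym (lookup-∷ʳ-inject₁ p x j)) (sym (lookup-∷ʳ-fromℕ p x)) v<x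
                 , subst₂ _<_ (sym (toℕ-inject₁ j)) (sym (toℕ-fromℕ n)) (toℕ<n j)

δ-∷ʳ : (p : Vec ℕ (suc n)) (x : ℕ) → δ (p ∷ʳ x) ≡ δ p ∷ʳ rank p x
δ-∷ʳ p x = trans (tabulate-∷ʳ (countBelow (p ∷ʳ x)))
                 (cong₂ _∷ʳ_ (tabulate-cong (countBelow-∷ʳ-inject₁ p x)) (countBelow-∷ʳ-fromℕ p x))

InA-δ : (a : Vec ℕ (suc n)) → InA (δ a)
InA-δ {zero}  (x ∷ []) zero = ≤-reflexive (countBelow-∷ʳ-fromℕ [] x)
InA-δ {suc n} a with initLast a
... | p , x , refl = subst InA (sym (δ-∷ʳ p x)) (from (InA-∷ʳ (δ p) (rank p x)) (InA-δ p , rank≤n p x))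

SelfDescribing : Vec ℕ (suc n) → Set
SelfDescribing a = δ a ≡ a

SelfDescribing⇒InA : (a : Vec ℕ (suc n)) → SelfDescribing a → InA a
SelfDescribing⇒InA a sd = subst InA sd (InA-δ a)

-- When p is self-describing, {y | Admissible p y} is the paper's S(p ∷ʳ x), for any x.
Admissible : Vec ℕ n → ℕ → Set
Admissible p y = rank p y ≡ y

SelfDescribing-∷ʳ : (p : Vec ℕ (suc n)) (x : ℕ) → SelfDescribing (p ∷ʳ x) ⇔ (SelfDescribing p × Admissible p x)
SelfDescribing-∷ʳ p x = mk⇔ (λ sd → ∷ʳ-injective _ _ (trans (sym (δ-∷ʳ p x)) sd))
                            (λ (sd , ad) → trans (δ-∷ʳ p x) (cong₂ _∷ʳ_ sd ad))

Admissible-∷ʳ : (p : Vec ℕ (suc n)) (x y : ℕ) → InA (p ∷ʳ x) →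
                Admissible (p ∷ʳ x) y ⇔ ((Admissible p y × y ≤ x) ⊎ y ≡ suc (suc n))
Admissible-∷ʳ {n} p x y h = mk⇔ classify realise
  where
  hp : InA p
  hp = proj₁ (to (InA-∷ʳ p x) h)
  x≤ : x ≤ suc n
  x≤ = proj₂ (to (InA-∷ʳ p x) h)
  classify : Admissible (p ∷ʳ x) y → (Admissible p y × y ≤ x) ⊎ y ≡ suc (suc n)
  classify ad with x <? y
  ... | no x≮y  = inj₁ (trans (sym (rank-∷ʳ-≮ p x x≮y)) ad , ≮⇒≥ x≮y)
  ... | yes x<y = inj₂ (≤-antisym (subst (_≤ suc (suc n)) ad (rank≤n (p ∷ʳ x) y)) (≰⇒> y≰))
    where
    y≰ : ¬ y ≤ suc n
    y≰ y≤ = <⇒≱ (≤-reflexive (trans (sym (rank-∷ʳ-< p x x<y)) ad)) (≤-rank p hp y≤)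
  realise : (Admissible p y × y ≤ x) ⊎ y ≡ suc (suc n) → Admissible (p ∷ʳ x) y
  realise (inj₁ (ad , y≤x)) = trans (rank-∷ʳ-≮ p x (≤⇒≯ y≤x)) ad
  realise (inj₂ refl)       = trans (rank-∷ʳ-< p x (s≤s x≤)) (cong suc rank-full)
    where
    rank-full : rank p (suc (suc n)) ≡ suc n
    rank-full = ≤-antisym (rank≤n p (suc (suc n))) (≤-trans (≤-rank p hp ≤-refl) (rank-mono p (n≤1+n _)))

SelfDescribing-∷ʳ-∷ʳ : (p : Vec ℕ (suc n)) (x y : ℕ) →
                       SelfDescribing ((p ∷ʳ x) ∷ʳ y) ⇔
                       (SelfDescribing (p ∷ʳ x) × ((SelfDescribing (p ∷ʳ y) × y ≤ x) ⊎ y ≡ suc (suc n)))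
SelfDescribing-∷ʳ-∷ʳ {n} p x y = mk⇔
  (λ sd′ → let sd , ad = to (SelfDescribing-∷ʳ (p ∷ʳ x) y) sd′ in sd , to (lastEntry sd) ad)
  (λ (sd , h) → from (SelfDescribing-∷ʳ (p ∷ʳ x) y) (sd , from (lastEntry sd) h))
  where
  lastEntry : SelfDescribing (p ∷ʳ x) →
              Admissible (p ∷ʳ x) y ⇔ ((SelfDescribing (p ∷ʳ y) × y ≤ x) ⊎ y ≡ suc (suc n))
  lastEntry sd = mk⇔ (Sum.map₁ (Product.map₁ (λ ad → from (SelfDescribing-∷ʳ p y) (sd-p , ad))) ∘ to classify)
                     (from classify ∘ Sum.map₁ (Product.map₁ (proj₂ ∘ to (SelfDescribing-∷ʳ p y))))
    where
    sd-p : SelfDescribing p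
    sd-p = proj₁ (to (SelfDescribing-∷ʳ p x) sd)
    classify : Admissible (p ∷ʳ x) y ⇔ ((Admissible p y × y ≤ x) ⊎ y ≡ suc (suc n))
    classify = Admissible-∷ʳ p x y (SelfDescribing⇒InA (p ∷ʳ x) sd)

Cat⇒SelfDescribing : {a : Vec ℕ (suc n)} → Cat n a → SelfDescribing a
Cat⇒SelfDescribing cat0                        = refl
Cat⇒SelfDescribing (cat1 _ (inj₁ (refl , _))) = refl
Cat⇒SelfDescribing (cat1 _ (inj₂ refl))       = refl
Cat⇒SelfDescribing (catS p x y c h) =
  from (SelfDescribing-∷ʳ-∷ʳ p x y) (Cat⇒SelfDescribing c , Sum.map₁ (Product.map₁ Cat⇒SelfDescribing) h)

SelfDescribing⇒Cat : (n : ℕ) (a : Vec ℕ (suc n)) → SelfDescribing a → Cat n a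
SelfDescribing⇒Cat zero (x ∷ []) sd with SelfDescribing⇒InA _ sd zero
... | z≤n = cat0
SelfDescribing⇒Cat (suc zero) (x ∷ y ∷ []) sd
  with SelfDescribing⇒InA _ sd zero | SelfDescribing⇒InA _ sd (suc zero)
... | z≤n | z≤n     = cat1 0 (inj₁ (refl , z≤n))
... | z≤n | s≤s z≤n = cat1 1 (inj₂ refl)
SelfDescribing⇒Cat (suc (suc n)) = extend (SelfDescribing⇒Cat (suc n))
  where
  extend : (∀ b → SelfDescribing b → Cat (suc n) b) → ∀ a → SelfDescribing a → Cat (suc (suc n)) a
  extend rec a sd with initLast a
  ... | b , y , refl with initLast b
  ... | p , x , refl with to (SelfDescribing-∷ʳ-∷ʳ p x y) sd
  ... | sd-px , h = catS p x y (rec (p ∷ʳ x) sd-px) (Sum.map₁ (Product.map₁ (rec (p ∷ʳ y))) h)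

iter-+ : {A : Set} (f : A → A) (s k : ℕ) (x : A) → iter f (s + k) x ≡ iter f s (iter f k x)
iter-+ f zero    k x = refl
iter-+ f (suc s) k x = cong f (iter-+ f s k x)

iter-suc : {A : Set} (f : A → A) (s : ℕ) (x : A) → iter f (suc s) x ≡ iter f s (f x)
iter-suc f zero    x = refl
iter-suc f (suc s) x = cong f (iter-suc f s x)

FixedWithin : {A : Set} → (A → A) → ℕ → A → Set
FixedWithin f d x = ∃[ s ] (s ≤ d × f (iter f s x) ≡ iter f s x)

module _ {A : Set} {f : A → A} {x : A} where

  fixedWithin-now : f x ≡ x → FixedWithin f d x
  fixedWithin-now fx≡x = 0 , z≤n , fx≡x

  fixedWithin-step : FixedWithin f d (f x) → FixedWithin f (suc d) x
  fixedWithin-step (s , s≤d , fixed) = suc s , s≤s s≤d , subst (λ v → f v ≡ v) (sym (iter-suc f s x)) fixed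

  fixedWithin-weaken : d ≤ d′ → FixedWithin f d x → FixedWithin f d′ x
  fixedWithin-weaken d≤d′ (s , s≤d , fixed) = s , ≤-trans s≤d d≤d′ , fixed

module _ {f : ℕ → ℕ} {L : ℕ}
         (f-mono : ∀ {y y′} → y ≤ y′ → f y ≤ f y′) (f≤L : ∀ y → f y ≤ L) where

  private
    ascend : ∀ d x → x ≤ f x → L ≤ d + x → FixedWithin f d x
    ascend zero    x x≤fx L≤x = fixedWithin-now (≤-antisym (≤-trans (f≤L x) L≤x) x≤fx)
    ascend (suc d) x x≤fx L≤  with f x ≟ x
    ... | yes fx≡x = fixedWithin-now fx≡x
    ... | no fx≢x  = fixedWithin-step (ascend d (f x) (f-mono x≤fx) L≤d+fx)
      where
      L≤d+fx : L ≤ d + f x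
      L≤d+fx = begin
        L           ≤⟨ L≤ ⟩
        suc d + x   ≡⟨ +-suc d x ⟨
        d + suc x   ≤⟨ +-monoʳ-≤ d (≤∧≢⇒< x≤fx (fx≢x ∘ sym)) ⟩
        d + f x     ∎
        where open ≤-Reasoning

    descend : ∀ d x → x ≤ d → f x ≤ x → FixedWithin f d x
    descend zero    x x≤0 fx≤x = fixedWithin-now (≤-antisym fx≤x (≤-trans x≤0 z≤n))
    descend (suc d) x x≤  fx≤x with f x ≟ x
    ... | yes fx≡x = fixedWithin-now fx≡x
    ... | no fx≢x  =
      fixedWithin-step (descend d (f x) (s≤s⁻¹ (<-≤-trans (≤∧≢⇒< fx≤x fx≢x) x≤)) (f-mono fx≤x))

  monotone-bounded⇒fixedWithin : ∀ x → x ≤ L → FixedWithin f L x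
  monotone-bounded⇒fixedWithin x x≤L with ≤-total x (f x)
  ... | inj₁ x≤fx = ascend L x x≤fx (m≤m+n L x)
  ... | inj₂ fx≤x = descend L x x≤L fx≤x

iter-δ-∷ʳ : (p : Vec ℕ (suc n)) (x : ℕ) → x ≤ suc n →
            ∀ k → ∃[ z ] (z ≤ suc n × iter δ k (p ∷ʳ x) ≡ iter δ k p ∷ʳ z)
iter-δ-∷ʳ p x x≤ zero    = x , x≤ , refl
iter-δ-∷ʳ p x x≤ (suc k) with iter-δ-∷ʳ p x x≤ k
... | z , _ , reached =
  rank (iter δ k p) z , rank≤n (iter δ k p) z , trans (cong δ reached) (δ-∷ʳ (iter δ k p) z)

iter-δ-∷ʳ-fixed : (q : Vec ℕ (suc n)) → SelfDescribing q →
                  ∀ s z → iter δ s (q ∷ʳ z) ≡ q ∷ʳ iter (rank q) s z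
iter-δ-∷ʳ-fixed q sd zero    z = refl
iter-δ-∷ʳ-fixed q sd (suc s) z = begin
  δ (iter δ s (q ∷ʳ z))  ≡⟨ cong δ (iter-δ-∷ʳ-fixed q sd s z) ⟩
  δ (q ∷ʳ w)             ≡⟨ δ-∷ʳ q w ⟩
  δ q ∷ʳ rank q w        ≡⟨ cong (_∷ʳ rank q w) sd ⟩
  q ∷ʳ rank q w          ∎
  where
  open ≡-Reasoning
  w : ℕ
  w = iter (rank q) s z

fixedWithin-∷ʳ : (p : Vec ℕ (suc n)) → x ≤ suc n →
                 FixedWithin δ d p → FixedWithin δ (suc n + d) (p ∷ʳ x)
fixedWithin-∷ʳ {n} {x} p x≤ (k , k≤d , sd) with iter-δ-∷ʳ p x x≤ k
... | z , z≤ , prefixed with monotone-bounded⇒fixedWithin (rank-mono (iter δ k p)) (rank≤n (iter δ k p)) z z≤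
... | s , s≤ , ad =
  s + k , +-mono-≤ s≤ k≤d , subst SelfDescribing (sym reached) (from (SelfDescribing-∷ʳ q w) (sd , ad))
  where
  open ≡-Reasoning
  q : Vec ℕ (suc n)
  q = iter δ k p
  w : ℕ
  w = iter (rank q) s z
  reached : iter δ (s + k) (p ∷ʳ x) ≡ q ∷ʳ w
  reached = begin
    iter δ (s + k) (p ∷ʳ x)       ≡⟨ iter-+ δ s k (p ∷ʳ x) ⟩
    iter δ s (iter δ k (p ∷ʳ x))  ≡⟨ cong (iter δ s) prefixed ⟩
    iter δ s (q ∷ʳ z)             ≡⟨ iter-δ-∷ʳ-fixed q sd s z ⟩
    q ∷ʳ w                        ∎

δ-fixedWithin : (a : Vec ℕ (suc n)) → InA a → FixedWithin δ (n * n) a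
δ-fixedWithin {zero}  (x ∷ []) h with h zero
... | z≤n = fixedWithin-now refl
δ-fixedWithin {suc n} a h with initLast a
... | p , x , refl with to (InA-∷ʳ p x) h
... | hp , x≤ = fixedWithin-weaken (+-monoʳ-≤ (suc n) (*-monoʳ-≤ n (n≤1+n n)))
                                   (fixedWithin-∷ʳ p x≤ (δ-fixedWithin p hp))

theorem2 :
    (∀ (n : ℕ) (a : Vec ℕ (suc n)) → Cat n a ⇔ (InA a × δ a ≡ a))
    × (∀ (n : ℕ) (a : Vec ℕ (suc n)) → InA a → ∃[ k ] Cat n (iter δ k a))
    × (∃[ c ] ∃[ N ] (∀ (n : ℕ) → N ≤ n → (a : Vec ℕ (suc n)) → InA a →
          ∃[ k ] (k ≤ c * (n * n) × Cat n (iter δ k a))))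
theorem2 = characterisation , convergence , 1 , 0 , quadratic
  where
  characterisation : ∀ n (a : Vec ℕ (suc n)) → Cat n a ⇔ (InA a × δ a ≡ a)
  characterisation n a = mk⇔ (λ c → SelfDescribing⇒InA a (Cat⇒SelfDescribing c) , Cat⇒SelfDescribing c)
                             (SelfDescribing⇒Cat n a ∘ proj₂)
  convergence : ∀ n (a : Vec ℕ (suc n)) → InA a → ∃[ k ] Cat n (iter δ k a)
  convergence n a h = let k , _ , sd = δ-fixedWithin a h in k , SelfDescribing⇒Cat n _ sd
  quadratic : ∀ n → 0 ≤ n → (a : Vec ℕ (suc n)) → InA a → ∃[ k ] (k ≤ 1 * (n * n) × Cat n (iter δ k a))
  quadratic n _ a h = let k , k≤ , sd = δ-fixedWithin a h in
    k , ≤-trans k≤ (≤-reflexive (sym (*-identityˡ (n * n)))) , SelfDescribing⇒Cat n _ sd
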